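{- Let $r,s$ be coprime positive integers and $c,k$ positive integers. Let $\mu$ be a partition whose Young diagram is strictly contained in the Young diagram of $\lambda_{r,s,k}$. Then every successor $\mu^+$ of $\mu$ with respect to $>_{r,s,c}$ has Young diagram contained in that of $\lambda_{r,s,k}$. In particular, $\lambda_{r,s,k}$ is an accumulation point for $>_{r,s,c}$.
   Context: Young diagrams consist of unit boxes $[i,i+1]\times[j,j+1]$ ($j\ge0$, $0\le i<\lambda_{j+1}$). $\lambda_{r,s,k}$ is the partition whose Young diagram consists of all boxes whose top right corner $(x,y)$ satisfies $sx+ry\le k$. On $\mathbb N^2$ define $(x_1,y_1)<_{r,s,c}(x_2,y_2)$ if either $sx_1+ry_1<sx_2+ry_2$, or $sx_1+ry_1=sx_2+ry_2$, $x_1-y_1\equiv x_2-y_2\pmod c$ and $x_1-y_1<x_2-y_2$. A partition $\lambda'$ is a successor of $\lambda$ (written $\lambda'>'_{r,s,c}\lambda$) if $\lambda'$ is obtained from $\lambda$ by adding one box whose bottom left corner is minimal with respect to $<_{r,s,c}$ among the bottom left corners of all boxes that can be added to $\lambda$ to give a partition. Write $\mu>_{r,s,c}\lambda$ if there is a chain $\lambda=\lambda_0<'_{r,s,c}\lambda_1<'_{r,s,c}\dots<'_{r,s,c}\lambda_m=\mu$. A partition $\mu$ is an accumulation point for $>_{r,s,c}$ if $\mu>_{r,s,c}\lambda$ for every partition $\lambda$ whose diagram is strictly contained in that of $\mu$. -}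

module Defs where

open import Data.Nat using (ℕ; zero; suc; _+_; _*_; _≤_; _<_; _≤?_)
open import Data.Integer using (ℤ; +_) renaming (_-_ to _-ℤ_; _<_ to _<ℤ_)
open import Data.Integer.Divisibility using () renaming (_∣_ to _∣ℤ_)
open import Data.List using (List; []; _∷_; length; filter; upTo; map)
open import Data.List.Relation.Unary.All using (All)
open import Data.List.Relation.Unary.Linked using (Linked)
open import Data.Product using (_×_; _,_; ∃; Σ)
open import Data.Sum using (_⊎_)
open import Relation.Nullary using (¬_)
open import Relation.Binary.PropositionalEquality using (_≡_)
open import Relation.Binary.Construct.Closure.ReflexiveTransitive using (Star)
open import Function.Bundles using (_⇔_)

-- A partition is its list of (positive, weakly decreasing) row lengths
-- λ₁ ≥ λ₂ ≥ … > 0.  This representation is canonical.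
IsPartition : List ℕ → Set
IsPartition p = Linked (λ a b → b ≤ a) p × All (0 <_) p

-- row j (0-indexed) of a partition: λ_{j+1}, and 0 beyond its length
row : List ℕ → ℕ → ℕ
row []       _       = 0
row (x ∷ _)  zero    = x
row (_ ∷ xs) (suc j) = row xs j

-- A box is identified by its bottom left corner (i , j): the box [i,i+1]×[j,j+1].
Box : Set
Box = ℕ × ℕ

_∈D_ : Box → List ℕ → Set
(i , j) ∈D p = i < row p j

_⊆D_ : List ℕ → List ℕ → Set
μ ⊆D ν = ∀ b → b ∈D μ → b ∈D ν

_⊂D_ : List ℕ → List ℕ → Set
μ ⊂D ν = μ ⊆D ν × ∃ λ b → b ∈D ν × ¬ (b ∈D μ)

-- λ_{r,s,k}: row j consists of the boxes (i , j) whose top right corner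
-- (i+1 , j+1) satisfies s(i+1) + r(j+1) ≤ k.  (For s ≥ 1 such i satisfy i < k,
-- and for r ≥ 1 only rows j < k are nonempty; empty rows are dropped.)
lamRowLen : ℕ → ℕ → ℕ → ℕ → ℕ
lamRowLen r s k j = length (filter (λ i → s * suc i + r * suc j ≤? k) (upTo k))

lam : ℕ → ℕ → ℕ → List ℕ
lam r s k = filter (λ n → 1 ≤? n) (map (lamRowLen r s k) (upTo k))

diff : Box → ℤ
diff (x , y) = + x -ℤ + y

_<[_,_,_]_ : Box → ℕ → ℕ → ℕ → Box → Set
(x₁ , y₁) <[ r , s , c ] (x₂ , y₂) =
  (s * x₁ + r * y₁ < s * x₂ + r * y₂)
  ⊎ ((s * x₁ + r * y₁ ≡ s * x₂ + r * y₂)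
     × ((+ c) ∣ℤ (diff (x₁ , y₁) -ℤ diff (x₂ , y₂)))
     × (diff (x₁ , y₁) <ℤ diff (x₂ , y₂)))

AddsBox : List ℕ → Box → List ℕ → Set
AddsBox p b p' = ¬ (b ∈D p) × (∀ b' → (b' ∈D p') ⇔ ((b' ∈D p) ⊎ (b' ≡ b)))

Addable : List ℕ → Box → Set
Addable p b = Σ (List ℕ) λ p' → IsPartition p' × AddsBox p b p'

Succ : ℕ → ℕ → ℕ → List ℕ → List ℕ → Set
Succ r s c p p' =
  IsPartition p' × Σ Box λ b → AddsBox p b p'
    × (∀ b' → Addable p b' → ¬ (b' <[ r , s , c ] b))

_>[_,_,_]_ : List ℕ → ℕ → ℕ → ℕ → List ℕ → Set
μ >[ r , s , c ] p = Star (Succ r s c) p μ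

AccumulationPoint : ℕ → ℕ → ℕ → List ℕ → Set
AccumulationPoint r s c μ = ∀ p → IsPartition p → p ⊂D μ → μ >[ r , s , c ] p

-- Weigh a box (x , y) by s x + r y.  The diagram of λ_{r,s,k} consists of the boxes whose top
-- right corner lies under the line s x + r y = k, so each of its boxes weighs less than every box
-- outside it.  If μ ⊊ λ_{r,s,k}, the nearest row at or below a missing box of λ_{r,s,k} in which
-- μ can grow yields an addable box of μ to the lower left of that missing box, hence inside
-- λ_{r,s,k}.  The box added by a successor is minimal for <_{r,s,c}, which refines the weight,
-- so it cannot lie outside λ_{r,s,k}.  Every partition has a successor, and the number of boxes
-- of λ_{r,s,k} still missing drops by one at each step, so λ_{r,s,k} is reached from any
-- μ ⊊ λ_{r,s,k}.
module Submission where

open import Defs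
open import Data.Nat using (ℕ; zero; suc; _+_; _*_; _∸_; _≤_; _<_; _≥_; z≤n; s≤s; s≤s⁻¹; >-nonZero)
open import Data.Nat.Properties
open import Data.Nat.Coprimality using (Coprime)
open import Data.Nat.Solver using (module +-*-Solver)
import Data.Integer as ℤ
import Data.Integer.Properties as ℤ
open import Data.List using (List; []; _∷_; length; filter; upTo; map; applyUpTo; [_]; _++_)
open import Data.List.Properties using (map-upTo; upTo-∷ʳ; length-upTo; filter-++; filter-all; filter-reject; ++-identityʳ)
open import Data.List.Relation.Unary.All using (All; []; _∷_)
open import Data.List.Relation.Unary.All.Properties using (all-filter; applyUpTo⁺₁)
open import Data.List.Relation.Unary.Linked using (Linked; []; [-]; _∷_; tail)
open import Data.Product using (_×_; _,_; ∃; ∃-syntax; proj₁; proj₂)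
open import Data.Sum using (_⊎_; inj₁; inj₂)
open import Data.Unit using (⊤; tt)
open import Data.Empty using (⊥-elim)
open import Function using (_∘_)
open import Function.Bundles using (_⇔_; mk⇔; Equivalence)
open import Relation.Nullary using (¬_; Dec; yes; no; contradiction)
open import Relation.Nullary.Decidable using (_⊎-dec_; _×-dec_)
open import Relation.Unary using (Decidable)
open import Relation.Binary.PropositionalEquality hiding ([_])
open import Relation.Binary.Construct.Closure.ReflexiveTransitive using (Star; ε; _◅_)
open import Relation.Binary.Definitions using (tri<; tri≈; tri>; Transitive; Irreflexive) renaming (Decidable to Decidable₂)

open Equivalence using (to; from)

≤-from-< : ∀ {a b} → (∀ {i} → i < a → i < b) → a ≤ b
≤-from-< {zero} _ = z≤n
≤-from-< {suc a} h = h (n<1+n a)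

below-suc : ∀ {Q : ℕ → Set} {n} → (∀ {j} → j < n → Q j) → Q n → ∀ {j} → j < suc n → Q j
below-suc {Q} Q<n Qn j<1+n with m<1+n⇒m<n∨m≡n j<1+n
... | inj₁ j<n  = Q<n j<n
... | inj₂ refl = Qn


module _ {P : ℕ → Set} (P? : Decidable P) (P-down : ∀ {i} → P (suc i) → P i) where

  P-≤ : ∀ {i n} → i ≤ n → P n → P i
  P-≤ {n = n} i≤n Pn with m≤n⇒m<n∨m≡n i≤n
  ... | inj₂ refl = Pn
  P-≤ {n = suc n} _ Pn | inj₁ i<1+n = P-≤ (s≤s⁻¹ i<1+n) (P-down Pn)

  length-filter-upTo-suc : ∀ n → ¬ P n →
    length (filter P? (upTo (suc n))) ≡ length (filter P? (upTo n))
  length-filter-upTo-suc n ¬Pn = begin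
    length (filter P? (upTo (suc n)))              ≡⟨ cong (length ∘ filter P?) (upTo-∷ʳ n) ⟨
    length (filter P? (upTo n ++ [ n ]))           ≡⟨ cong length (filter-++ P? (upTo n) [ n ]) ⟩
    length (filter P? (upTo n) ++ filter P? [ n ]) ≡⟨ cong (length ∘ (filter P? (upTo n) ++_)) (filter-reject P? ¬Pn) ⟩
    length (filter P? (upTo n) ++ [])              ≡⟨ cong length (++-identityʳ (filter P? (upTo n))) ⟩
    length (filter P? (upTo n))                    ∎
    where open ≡-Reasoning

  <-length-filter-upTo : ∀ n {i} → i < length (filter P? (upTo n)) ⇔ (i < n × P i)
  <-length-filter-upTo zero = mk⇔ (λ ()) (λ ())
  <-length-filter-upTo (suc n) {i} with P? n
  ... | yes Pn rewrite filter-all P? (applyUpTo⁺₁ _ (suc n) (λ j<1+n → P-≤ (s≤s⁻¹ j<1+n) Pn))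
                     | length-upTo (suc n) =
    mk⇔ (λ i<1+n → i<1+n , P-≤ (s≤s⁻¹ i<1+n) Pn) proj₁
  ... | no ¬Pn rewrite length-filter-upTo-suc n ¬Pn =
    mk⇔ (λ i<L → let i<n , Pi = to (<-length-filter-upTo n) i<L in m<n⇒m<1+n i<n , Pi) below
    where
    below : i < suc n × P i → i < length (filter P? (upTo n))
    below (i<1+n , Pi) with m<1+n⇒m<n∨m≡n i<1+n
    ... | inj₁ i<n = from (<-length-filter-upTo n) (i<n , Pi)
    ... | inj₂ refl = contradiction Pi ¬Pn

linked-∷ : ∀ {x ys} → row ys 0 ≤ x → Linked _≥_ ys → Linked _≥_ (x ∷ ys)
linked-∷ {ys = []}    _   _  = [-]
linked-∷ {ys = _ ∷ _} y≤x ys = y≤x ∷ ys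

row-antitone : ∀ {p} → Linked _≥_ p → ∀ j → row p (suc j) ≤ row p j
row-antitone []         _       = z≤n
row-antitone [-]        _       = z≤n
row-antitone (y≤x ∷ _)  zero    = y≤x
row-antitone (_ ∷ p)    (suc j) = row-antitone p j

row-after-0 : ∀ {xs} → Linked _≥_ (0 ∷ xs) → ∀ j → row (0 ∷ xs) j ≡ 0
row-after-0 _            zero    = refl
row-after-0 [-]          (suc j) = refl
row-after-0 (z≤n ∷ 0∷xs) (suc j) = row-after-0 0∷xs j

row-filter-positive : ∀ {xs} → Linked _≥_ xs → ∀ j → row (filter (1 ≤?_) xs) j ≡ row xs j
row-filter-positive {[]}         _ _       = refl
row-filter-positive {suc x ∷ xs} _ zero    = refl
row-filter-positive {suc x ∷ xs} l (suc j) = row-filter-positive (tail l) j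
row-filter-positive {0 ∷ xs}     l j       =
  trans (row-filter-positive (tail l) j) (trans (row-after-0 l (suc j)) (sym (row-after-0 l j)))

linked-applyUpTo : ∀ {f} → (∀ t → f (suc t) ≤ f t) → ∀ n → Linked _≥_ (applyUpTo f n)
linked-applyUpTo f↓ zero          = []
linked-applyUpTo f↓ (suc zero)    = [-]
linked-applyUpTo f↓ (suc (suc n)) = f↓ 0 ∷ linked-applyUpTo (f↓ ∘ suc) (suc n)

row-applyUpTo : ∀ f {n j} → j < n → row (applyUpTo f n) j ≡ f j
row-applyUpTo f {suc n} {zero}  _   = refl
row-applyUpTo f {suc n} {suc j} j<n = row-applyUpTo (f ∘ suc) (s≤s⁻¹ j<n)

row-applyUpTo-≥ : ∀ f {n j} → n ≤ j → row (applyUpTo f n) j ≡ 0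
row-applyUpTo-≥ f {zero}              _         = refl
row-applyUpTo-≥ f {suc n} {suc j} (s≤s n≤j) = row-applyUpTo-≥ (f ∘ suc) n≤j

module Staircase (r s k : ℕ) where

  UnderLine : Box → Set
  UnderLine (i , j) = s * suc i + r * suc j ≤ k

  underLine-≤ : ∀ {i j i₀ j₀} → i ≤ i₀ → j ≤ j₀ → UnderLine (i₀ , j₀) → UnderLine (i , j)
  underLine-≤ i≤ j≤ = ≤-trans (+-mono-≤ (*-monoʳ-≤ s (s≤s i≤)) (*-monoʳ-≤ r (s≤s j≤)))

  underLine-weight< : ∀ {i j x y} → UnderLine (i , j) → ¬ UnderLine (x , y) →
    s * i + r * j < s * x + r * y
  underLine-weight< {i} {j} {x} {y} below ¬below =
    +-cancelʳ-< (s + r) _ _ (begin-strict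
      s * i + r * j + (s + r)  ≡⟨ shift i j ⟨
      s * suc i + r * suc j    ≤⟨ below ⟩
      k                        <⟨ ≰⇒> ¬below ⟩
      s * suc x + r * suc y    ≡⟨ shift x y ⟩
      s * x + r * y + (s + r)  ∎)
    where
    shift : ∀ a b → s * suc a + r * suc b ≡ (s * a + r * b) + (s + r)
    shift a b rewrite *-suc s a | *-suc r b =
      solve 4 (λ s r a b → (s :+ s :* a) :+ (r :+ r :* b) := (s :* a :+ r :* b) :+ (s :+ r)) refl s r a b
      where open +-*-Solver
    open ≤-Reasoning

  underLine⇒i<k : 0 < s → ∀ {i j} → UnderLine (i , j) → i < k
  underLine⇒i<k s>0 {i} below = ≤-trans (m≤n*m (suc i) s {{>-nonZero s>0}}) (≤-trans (m≤m+n _ _) below)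

  underLine⇒j<k : 0 < r → ∀ {i j} → UnderLine (i , j) → j < k
  underLine⇒j<k r>0 {j = j} below = ≤-trans (m≤n*m (suc j) r {{>-nonZero r>0}}) (≤-trans (m≤n+m _ _) below)

  <-lamRowLen : 0 < s → ∀ {i j} → i < lamRowLen r s k j ⇔ UnderLine (i , j)
  <-lamRowLen s>0 {j = j} = mk⇔ (proj₂ ∘ to count) (λ below → from count (underLine⇒i<k s>0 below , below))
    where
    count : ∀ {i} → i < lamRowLen r s k j ⇔ (i < k × UnderLine (i , j))
    count = <-length-filter-upTo (λ i → s * suc i + r * suc j ≤? k)
              (≤-trans (+-monoˡ-≤ (r * suc j) (*-monoʳ-≤ s (n≤1+n _)))) k

  lamRowLen-antitone : 0 < s → ∀ j → lamRowLen r s k (suc j) ≤ lamRowLen r s k j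
  lamRowLen-antitone s>0 j = ≤-from-< λ i<len →
    from (<-lamRowLen s>0) (≤-trans (+-monoʳ-≤ _ (*-monoʳ-≤ r (n≤1+n _))) (to (<-lamRowLen s>0) i<len))

  lam-positive : All (0 <_) (lam r s k)
  lam-positive = all-filter (1 ≤?_) (map (lamRowLen r s k) (upTo k))

  ∈D-lam : 0 < r → 0 < s → ∀ {i j} → (i , j) ∈D lam r s k ⇔ UnderLine (i , j)
  ∈D-lam r>0 s>0 {i} {j} rewrite map-upTo (lamRowLen r s k) k
                               | row-filter-positive (linked-applyUpTo (lamRowLen-antitone s>0) k) j
    with j <? k
  ... | yes j<k rewrite row-applyUpTo (lamRowLen r s k) j<k = <-lamRowLen s>0
  ... | no j≮k  rewrite row-applyUpTo-≥ (lamRowLen r s k) (≮⇒≥ j≮k) =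
    mk⇔ (λ ()) (λ below → contradiction (underLine⇒j<k r>0 below) j≮k)

addBox : List ℕ → ℕ → List ℕ
addBox []       _       = 1 ∷ []
addBox (x ∷ xs) zero    = suc x ∷ xs
addBox (x ∷ xs) (suc j) = x ∷ addBox xs j

row-addBox-≡ : ∀ p {j} → j ≤ length p → row (addBox p j) j ≡ suc (row p j)
row-addBox-≡ []      {zero}  _         = refl
row-addBox-≡ (x ∷ p) {zero}  _         = refl
row-addBox-≡ (x ∷ p) {suc j} (s≤s j≤n) = row-addBox-≡ p j≤n

row-addBox-≢ : ∀ p {j j′} → j ≤ length p → j′ ≢ j → row (addBox p j) j′ ≡ row p j′
row-addBox-≢ []      {zero}  {zero}    _         j′≢j = contradiction refl j′≢j
row-addBox-≢ []      {zero}  {suc j′}  _         _    = refl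
row-addBox-≢ (x ∷ p) {zero}  {zero}    _         j′≢j = contradiction refl j′≢j
row-addBox-≢ (x ∷ p) {zero}  {suc j′}  _         _    = refl
row-addBox-≢ (x ∷ p) {suc j} {zero}    _         _    = refl
row-addBox-≢ (x ∷ p) {suc j} {suc j′}  (s≤s j≤n) j′≢j = row-addBox-≢ p j≤n (j′≢j ∘ cong suc)

Extendable : List ℕ → ℕ → Set
Extendable p zero    = ⊤
Extendable p (suc j) = row p (suc j) < row p j

extendable? : ∀ p j → Dec (Extendable p j)
extendable? p zero    = yes tt
extendable? p (suc j) = row p (suc j) <? row p j

row>0⇒<length : ∀ p {j} → 0 < row p j → j < length p
row>0⇒<length (x ∷ p) {zero}  _     = s≤s z≤n
row>0⇒<length (x ∷ p) {suc j} row>0 = s≤s (row>0⇒<length p row>0)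

extendable⇒≤length : ∀ p {j} → Extendable p j → j ≤ length p
extendable⇒≤length p {zero}  _   = z≤n
extendable⇒≤length p {suc j} ext = row>0⇒<length p (<-≤-trans (s≤s z≤n) ext)

addBox-linked : ∀ {p j} → Linked _≥_ p → Extendable p j → j ≤ length p → Linked _≥_ (addBox p j)
addBox-linked {[]}    {zero}        _ _   _         = [-]
addBox-linked {x ∷ p} {zero}        l _   _         = linked-∷ (m≤n⇒m≤1+n (row-antitone l 0)) (tail l)
addBox-linked {x ∷ p} {suc zero}    l ext _         =
  linked-∷ (subst (_≤ x) (sym (row-addBox-≡ p z≤n)) ext) (addBox-linked (tail l) tt z≤n)
addBox-linked {x ∷ p} {suc (suc j)} l ext (s≤s j≤n) =
  linked-∷ (subst (_≤ x) (sym (row-addBox-≢ p j≤n (λ ()))) (row-antitone l 0))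
           (addBox-linked (tail l) ext j≤n)

addBox-positive : ∀ p j → All (0 <_) p → All (0 <_) (addBox p j)
addBox-positive []      _       _          = s≤s z≤n ∷ []
addBox-positive (x ∷ p) zero    (_ ∷ p>0)  = s≤s z≤n ∷ p>0
addBox-positive (x ∷ p) (suc j) (x>0 ∷ p>0) = x>0 ∷ addBox-positive p j p>0

corner : List ℕ → ℕ → Box
corner p j = row p j , j

addsBox-addBox : ∀ p {j} → j ≤ length p → AddsBox p (corner p j) (addBox p j)
addsBox-addBox p {j} j≤n = n≮n (row p j) , λ (i , j′) → ∈D-addBox i j′
  where
  ∈D-addBox : ∀ i j′ → (i < row (addBox p j) j′) ⇔ ((i < row p j′) ⊎ ((i , j′) ≡ (row p j , j)))
  ∈D-addBox i j′ with j′ ≟ j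
  ... | yes refl rewrite row-addBox-≡ p j≤n = mk⇔ split join
    where
    split : i < suc (row p j) → (i < row p j) ⊎ ((i , j) ≡ (row p j , j))
    split i<1+n with m<1+n⇒m<n∨m≡n i<1+n
    ... | inj₁ i<n  = inj₁ i<n
    ... | inj₂ refl = inj₂ refl
    join : (i < row p j) ⊎ ((i , j) ≡ (row p j , j)) → i < suc (row p j)
    join (inj₁ i<n)  = m<n⇒m<1+n i<n
    join (inj₂ refl) = n<1+n _
  ... | no j′≢j rewrite row-addBox-≢ p j≤n j′≢j = mk⇔ inj₁ λ where
    (inj₁ i<n) → i<n
    (inj₂ eq)  → contradiction (cong proj₂ eq) j′≢j

addBox-isPartition : ∀ {p j} → IsPartition p → Extendable p j → IsPartition (addBox p j)
addBox-isPartition {p} {j} (l , p>0) ext =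
  addBox-linked l ext (extendable⇒≤length p ext) , addBox-positive p j p>0

addable-extendable : ∀ {p j} → IsPartition p → Extendable p j → Addable p (corner p j)
addable-extendable {p} p-part ext =
  _ , addBox-isPartition p-part ext , addsBox-addBox p (extendable⇒≤length p ext)

addable⇒extendable : ∀ {p i j} → Addable p (i , j) → i ≡ row p j × Extendable p j
addable⇒extendable {p} {i} {j} (p′ , (l′ , _) , i∉p , ∈p′⇔) = i≡row , extendable j refl
  where
  ∈p′ : ∀ {a b} → a < row p′ b → (a < row p b) ⊎ ((a , b) ≡ (i , j))
  ∈p′ {a} {b} = to (∈p′⇔ (a , b))
  i∈p′ : i < row p′ j
  i∈p′ = from (∈p′⇔ (i , j)) (inj₂ refl)
  i≡row : i ≡ row p j
  i≡row with <-cmp i (row p j)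
  ... | tri< i<n _ _ = contradiction i<n i∉p
  ... | tri≈ _ eq _  = eq
  ... | tri> _ _ n<i with ∈p′ (<-trans n<i i∈p′)
  ...   | inj₁ n<n = contradiction n<n (n≮n _)
  ...   | inj₂ eq  = contradiction (cong proj₁ eq) (<⇒≢ n<i)
  extendable : ∀ j₀ → j₀ ≡ j → Extendable p j₀
  extendable zero     _    = tt
  extendable (suc j₀) refl with ∈p′ (<-≤-trans i∈p′ (row-antitone l′ j₀))
  ... | inj₁ i<row = subst (_< row p j₀) i≡row i<row
  ... | inj₂ eq    = contradiction (cong proj₂ eq) (<⇒≢ (n<1+n j₀))

extendable-below : ∀ p {i₀} j₀ → row p j₀ ≤ i₀ → ∃[ j ] (j ≤ j₀ × row p j ≤ i₀ × Extendable p j)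
extendable-below p zero     row≤i = zero , z≤n , row≤i , tt
extendable-below p (suc j₀) row≤i with row p (suc j₀) <? row p j₀
... | yes ext = suc j₀ , ≤-refl , row≤i , ext
... | no ¬ext with extendable-below p j₀ (≤-trans (≮⇒≥ ¬ext) row≤i)
...   | j , j≤j₀ , row≤ , ext = j , m≤n⇒m≤1+n j≤j₀ , row≤ , ext

module _ {A : Set} {_≺_ : A → A → Set} (≺-trans : Transitive _≺_) (≺-irrefl : Irreflexive _≡_ _≺_)
         (_≺?_ : Decidable₂ _≺_) {P : ℕ → Set} (P? : Decidable P) (f : ℕ → A) where

  NotBelow : ℕ → ℕ → Set
  NotBelow m j = P j → ¬ f j ≺ f m

  MinimalBelow : ℕ → ℕ → Set
  MinimalBelow n m = m < n × P m × (∀ {j} → j < n → NotBelow m j)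

  minimal-below : ∀ n → (∀ {j} → j < n → ¬ P j) ⊎ ∃ (MinimalBelow n)
  minimal-below zero = inj₁ λ ()
  minimal-below (suc n) with minimal-below n | P? n
  ... | inj₁ none | no ¬Pn = inj₁ (below-suc none ¬Pn)
  ... | inj₁ none | yes Pn =
    inj₂ (n , n<1+n n , Pn ,
          below-suc {NotBelow n} (λ j<n Pj → contradiction Pj (none j<n)) (λ _ → ≺-irrefl refl))
  ... | inj₂ (m , m<n , Pm , min) | no ¬Pn =
    inj₂ (m , m<n⇒m<1+n m<n , Pm , below-suc {NotBelow m} min (λ Pn → contradiction Pn ¬Pn))
  ... | inj₂ (m , m<n , Pm , min) | yes Pn with f n ≺? f m
  ...   | yes n≺m = inj₂ (n , n<1+n n , Pn ,
                          below-suc {NotBelow n} (λ j<n Pj j≺n → min j<n Pj (≺-trans j≺n n≺m))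
                                                 (λ _ → ≺-irrefl refl))
  ...   | no n⊀m  = inj₂ (m , m<n⇒m<1+n m<n , Pm , below-suc {NotBelow m} min (λ _ → n⊀m))

  ∃-minimal-below : ∀ {n m} → m < n → P m → ∃ (MinimalBelow n)
  ∃-minimal-below {n} m<n Pm with minimal-below n
  ... | inj₁ none = contradiction Pm (none m<n)
  ... | inj₂ min  = min

sumBelow : (ℕ → ℕ) → ℕ → ℕ
sumBelow f zero    = 0
sumBelow f (suc n) = f n + sumBelow f n

sumBelow-cong : ∀ {f g} n → (∀ {t} → t < n → f t ≡ g t) → sumBelow f n ≡ sumBelow g n
sumBelow-cong zero    _   = refl
sumBelow-cong (suc n) f≡g = cong₂ _+_ (f≡g (n<1+n n)) (sumBelow-cong n (f≡g ∘ m<n⇒m<1+n))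

sumBelow-suc-at : ∀ {f g n j} → j < n → (∀ {t} → t ≢ j → f t ≡ g t) → f j ≡ suc (g j) →
  sumBelow f n ≡ suc (sumBelow g n)
sumBelow-suc-at {f} {g} {suc n} j<1+n f≡g fj≡ with m<1+n⇒m<n∨m≡n j<1+n
... | inj₂ refl = cong₂ _+_ fj≡ (sumBelow-cong n (λ t<n → f≡g (<⇒≢ t<n)))
... | inj₁ j<n  = begin
  f n + sumBelow f n        ≡⟨ cong₂ _+_ (f≡g (<⇒≢ j<n ∘ sym)) (sumBelow-suc-at j<n f≡g fj≡) ⟩
  g n + suc (sumBelow g n)  ≡⟨ +-suc (g n) (sumBelow g n) ⟩
  suc (g n + sumBelow g n)  ∎
  where open ≡-Reasoning

sumBelow≡0 : ∀ f {n t} → sumBelow f n ≡ 0 → t < n → f t ≡ 0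
sumBelow≡0 f {suc n} sum≡0 =
  below-suc (sumBelow≡0 f (m+n≡0⇒n≡0 (f n) sum≡0)) (m+n≡0⇒m≡0 (f n) sum≡0)

sumBelow-positive : ∀ f {n} → 0 < sumBelow f n → ∃[ t ] (t < n × 0 < f t)
sumBelow-positive f {suc n} sum>0 with f n in fn≡
... | suc _ = n , n<1+n n , subst (0 <_) (sym fn≡) (s≤s z≤n)
... | zero with sumBelow-positive f sum>0
...   | t , t<n , ft>0 = t , m<n⇒m<1+n t<n , ft>0

module _ (r s c : ℕ) where

  weight : Box → ℕ
  weight (x , y) = s * x + r * y

  -- <_{r,s,c} without its congruence condition: a decidable strict order whose minimal
  -- elements are also <_{r,s,c}-minimal.
  _≺_ : Box → Box → Set
  a ≺ b = weight a < weight b ⊎ (weight a ≡ weight b × diff a ℤ.< diff b)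

  ≺-trans : Transitive _≺_
  ≺-trans (inj₁ a<b)        (inj₁ b<d)        = inj₁ (<-trans a<b b<d)
  ≺-trans (inj₁ a<b)        (inj₂ (b≡d , _))  = inj₁ (<-≤-trans a<b (≤-reflexive b≡d))
  ≺-trans (inj₂ (a≡b , _))  (inj₁ b<d)        = inj₁ (≤-<-trans (≤-reflexive a≡b) b<d)
  ≺-trans (inj₂ (a≡b , a<b)) (inj₂ (b≡d , b<d)) = inj₂ (trans a≡b b≡d , ℤ.<-trans a<b b<d)

  ≺-irrefl : Irreflexive _≡_ _≺_
  ≺-irrefl refl (inj₁ a<a)      = n≮n _ a<a
  ≺-irrefl refl (inj₂ (_ , a<a)) = ℤ.<-irrefl refl a<a

  _≺?_ : Decidable₂ _≺_
  a ≺? b = (weight a <? weight b) ⊎-dec ((weight a ≟ weight b) ×-dec (diff a ℤ.<? diff b))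

  <[]⇒≺ : ∀ {a b} → a <[ r , s , c ] b → a ≺ b
  <[]⇒≺ (inj₁ a<b)             = inj₁ a<b
  <[]⇒≺ (inj₂ (a≡b , _ , a<b)) = inj₂ (a≡b , a<b)

  successor : ∀ {p} → IsPartition p → ∃[ j ] (j ≤ length p × Succ r s c p (addBox p j))
  successor {p} p-part
    with ∃-minimal-below ≺-trans ≺-irrefl _≺?_ (extendable? p) (corner p) {suc (length p)} (s≤s z≤n) tt
  ... | j , _ , ext , minimal =
    j , j≤n , addBox-isPartition p-part ext , corner p j , addsBox-addBox p j≤n , not-below
    where
    j≤n : j ≤ length p
    j≤n = extendable⇒≤length p ext
    not-below : ∀ b → Addable p b → ¬ (b <[ r , s , c ] corner p j)
    not-below (i , j′) addable b<corner with addable⇒extendable {p} addable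
    ... | refl , ext′ = minimal (s≤s (extendable⇒≤length p ext′)) ext′ (<[]⇒≺ b<corner)

row-injective : ∀ {xs ys} → All (0 <_) xs → All (0 <_) ys → (∀ j → row xs j ≡ row ys j) → xs ≡ ys
row-injective {[]}    {[]}    _           _           _  = refl
row-injective {[]}    {_ ∷ _} _           (y>0 ∷ _)   eq = contradiction (eq 0) (<⇒≢ y>0)
row-injective {_ ∷ _} {[]}    (x>0 ∷ _)   _           eq = contradiction (sym (eq 0)) (<⇒≢ x>0)
row-injective {_ ∷ _} {_ ∷ _} (_ ∷ xs>0)  (_ ∷ ys>0)  eq =
  cong₂ _∷_ (eq 0) (row-injective xs>0 ys>0 (eq ∘ suc))

⊆D⇒row≤ : ∀ {μ ν} → μ ⊆D ν → ∀ j → row μ j ≤ row ν j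
⊆D⇒row≤ μ⊆ν j = ≤-from-< (μ⊆ν (_ , j))

⊆D-antisym : ∀ {μ ν} → All (0 <_) μ → All (0 <_) ν → μ ⊆D ν → ν ⊆D μ → μ ≡ ν
⊆D-antisym {μ} {ν} μ>0 ν>0 μ⊆ν ν⊆μ =
  row-injective μ>0 ν>0 (λ j → ≤-antisym (⊆D⇒row≤ {μ} {ν} μ⊆ν j) (⊆D⇒row≤ {ν} {μ} ν⊆μ j))

module Accumulation (r s c k : ℕ) (r>0 : 0 < r) (s>0 : 0 < s) where

  open Staircase r s k

  successor-⊆ : ∀ {μ μ⁺} → IsPartition μ → μ ⊂D lam r s k → Succ r s c μ μ⁺ → μ⁺ ⊆D lam r s k
  successor-⊆ {μ} μ-part (μ⊆ , (i₀ , j₀) , b₀∈ , b₀∉) (_ , (x , y) , (_ , ∈μ⁺⇔) , minimal) b b∈μ⁺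
    with to (∈μ⁺⇔ b) b∈μ⁺
  ... | inj₁ b∈μ  = μ⊆ b b∈μ
  ... | inj₂ refl with s * suc x + r * suc y ≤? k
  ...   | yes below = from (∈D-lam r>0 s>0) below
  ...   | no ¬below with extendable-below μ j₀ (≮⇒≥ b₀∉)
  ...     | j , j≤j₀ , row≤i₀ , ext =
    ⊥-elim (minimal (corner μ j) (addable-extendable μ-part ext)
             (inj₁ (underLine-weight< (underLine-≤ row≤i₀ j≤j₀ (to (∈D-lam r>0 s>0) b₀∈)) ¬below)))

  gap : List ℕ → ℕ → ℕ
  gap p j = row (lam r s k) j ∸ row p j

  defect : List ℕ → ℕ
  defect p = sumBelow (gap p) k

  defect-addBox : ∀ p {j} → j ≤ length p → corner p j ∈D lam r s k →
    defect p ≡ suc (defect (addBox p j))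
  defect-addBox p {j} j≤n corner∈ =
    sumBelow-suc-at (underLine⇒j<k r>0 (to (∈D-lam r>0 s>0) corner∈))
      (λ j′≢j → cong (row (lam r s k) _ ∸_) (sym (row-addBox-≢ p j≤n j′≢j)))
      (begin
        row (lam r s k) j ∸ row p j                  ≡⟨ +-∸-assoc 1 corner∈ ⟩
        suc (row (lam r s k) j ∸ suc (row p j))      ≡⟨ cong (suc ∘ (row (lam r s k) j ∸_)) (row-addBox-≡ p j≤n) ⟨
        suc (row (lam r s k) j ∸ row (addBox p j) j) ∎)
    where open ≡-Reasoning

  defect≡0⇒⊇ : ∀ p → defect p ≡ 0 → lam r s k ⊆D p
  defect≡0⇒⊇ p defect≡0 (i , j) i<row =
    <-≤-trans i<row (m∸n≡0⇒m≤n (sumBelow≡0 (gap p) defect≡0 j<k))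
    where
    j<k : j < k
    j<k = underLine⇒j<k r>0 (to (∈D-lam r>0 s>0) i<row)

  defect>0⇒missing : ∀ p → 0 < defect p → ∃ λ b → b ∈D lam r s k × ¬ b ∈D p
  defect>0⇒missing p defect>0 with sumBelow-positive (gap p) {k} defect>0
  ... | j , _ , gap>0 = corner p j , m∸n≢0⇒n<m (<⇒≢ gap>0 ∘ sym) , n≮n (row p j)

  reach : ∀ n {p} → IsPartition p → p ⊆D lam r s k → defect p ≡ n → lam r s k >[ r , s , c ] p
  reach zero    {p} p-part p⊆ defect≡0 =
    subst (Star (Succ r s c) _) (⊆D-antisym (proj₂ p-part) lam-positive p⊆ (defect≡0⇒⊇ p defect≡0)) ε
  reach (suc n) {p} p-part p⊆ defect≡ with successor r s c p-part
  ... | j , j≤n , p⁺-succ@(p⁺-part , _) =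
    p⁺-succ ◅ reach n p⁺-part p⁺⊆ (suc-injective (trans (sym defect≡+1) defect≡))
    where
    p⁺⊆ : addBox p j ⊆D lam r s k
    p⁺⊆ = successor-⊆ p-part (p⊆ , defect>0⇒missing p (subst (0 <_) (sym defect≡) (s≤s z≤n))) p⁺-succ
    defect≡+1 : defect p ≡ suc (defect (addBox p j))
    defect≡+1 = defect-addBox p j≤n (p⁺⊆ (corner p j) corner∈p⁺)
      where
      corner∈p⁺ : corner p j ∈D addBox p j
      corner∈p⁺ = subst (row p j <_) (sym (row-addBox-≡ p j≤n)) (n<1+n _)

proposition4p14 : (r s c k : ℕ) → 0 < r → 0 < s → Coprime r s → 0 < c → 0 < k →
    ((μ : List ℕ) → IsPartition μ → μ ⊂D lam r s k →
      (μ⁺ : List ℕ) → Succ r s c μ μ⁺ → μ⁺ ⊆D lam r s k)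
    × AccumulationPoint r s c (lam r s k)
proposition4p14 r s c k r>0 s>0 _ _ _ =
  (λ _ μ-part μ⊂λ _ → successor-⊆ μ-part μ⊂λ) ,
  (λ p p-part (p⊆λ , _) → reach (defect p) p-part p⊆λ refl)
  where open Accumulation r s c k r>0 s>0
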